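{- Let $D$ be a strongly connected balanced bipartite digraph of order $2a$, where $a\geq 2$, such that $d(u)+d(v)\geq 3a+1$ for every dominating pair $\{u,v\}$ of vertices of $D$. Suppose that $D$ is not hamiltonian. Then for every vertex $u\in V(D)$ there exists a vertex $v\in V(D)\setminus\{u\}$ such that $\{u,v\}$ is a dominating pair.
   Context: Digraphs have no loops and no multiple arcs. For a vertex $v$, $d(v)=d^+(v)+d^-(v)$ (out-degree plus in-degree). A pair of distinct vertices $\{u,v\}$ is dominating if there is a vertex $w$ with $uw$ and $vw$ both arcs of $D$. Balanced bipartite: two partite sets of equal size $a$. Hamiltonian: contains a directed cycle through all vertices. -}

module Defs where

open import Data.Nat using (ℕ; zero; suc; _+_; _∸_)
open import Data.Bool using (Bool; true; false; T)
open import Data.Fin using (Fin; toℕ)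
import Data.Fin as F
open import Data.Sum using (_⊎_; inj₁; inj₂)
open import Data.Product using (Σ; _×_; ∃-syntax)
open import Data.Empty using (⊥)
open import Relation.Binary.PropositionalEquality using (_≡_)
open import Relation.Nullary using (¬_)
open import Relation.Binary.Construct.Closure.ReflexiveTransitive using (Star)
open import Function.Definitions using (Bijective)

count : {n : ℕ} → (Fin n → Bool) → ℕ
count {zero}  p = 0
count {suc n} p with p F.zero
... | true  = suc (count (λ i → p (F.suc i)))
... | false = count (λ i → p (F.suc i))

-- A balanced bipartite digraph with partite sets X = Fin a, Y = Fin a.
-- Vertices: inj₁ x (x ∈ X) and inj₂ y (y ∈ Y).
-- Arcs only go between the partite sets (so no loops); being given by
-- Boolean adjacency, there are no multiple arcs.
record BBDigraph (a : ℕ) : Set where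
  field
    XY : Fin a → Fin a → Bool
    YX : Fin a → Fin a → Bool

Vertex : ℕ → Set
Vertex a = Fin a ⊎ Fin a

module _ {a : ℕ} (D : BBDigraph a) where
  open BBDigraph D

  Arc : Vertex a → Vertex a → Set
  Arc (inj₁ x) (inj₁ _) = ⊥
  Arc (inj₁ x) (inj₂ y) = T (XY x y)
  Arc (inj₂ y) (inj₁ x) = T (YX y x)
  Arc (inj₂ _) (inj₂ _) = ⊥

  outdeg : Vertex a → ℕ
  outdeg (inj₁ x) = count (λ y → XY x y)
  outdeg (inj₂ y) = count (λ x → YX y x)

  indeg : Vertex a → ℕ
  indeg (inj₁ x) = count (λ y → YX y x)
  indeg (inj₂ y) = count (λ x → XY x y)

  deg : Vertex a → ℕ
  deg v = outdeg v + indeg v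

  StronglyConnected : Set
  StronglyConnected = (u v : Vertex a) → Star Arc u v

  DominatingPair : Vertex a → Vertex a → Set
  DominatingPair u v = ¬ (u ≡ v) × (∃[ w ] (Arc u w × Arc v w))

  CycNext : {n : ℕ} → Fin n → Fin n → Set
  CycNext {n} i j = (toℕ j ≡ suc (toℕ i)) ⊎ ((toℕ i ≡ n ∸ 1) × (toℕ j ≡ 0))

  Hamiltonian : Set
  Hamiltonian = Σ (Fin (a + a) → Vertex a) λ f →
    Bijective _≡_ _≡_ f × ((i j : Fin (a + a)) → CycNext i j → Arc (f i) (f j))

module Submission where

-- Proof idea.  Call a vertex *unpaired* if it belongs to no dominating
-- pair.  If u were unpaired, D would be hamiltonian:
--
--  * Unpaired vertices spread along arcs: if v is unpaired and v → w, then
--    v is the only in-neighbour of w, so d⁻(w) ≤ 1.  Were {w, w'} dominating,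
--    the degree condition would give d⁻(w') ≥ 3a+1 − a − 1 − a = a, i.e.
--    every vertex of v's side (including v and a second one, as a ≥ 2)
--    points to w', and v would be paired.  By strong connectivity every
--    vertex is therefore unpaired.
--  * If no vertex is paired, every vertex has in-degree ≤ 1.  Choosing an
--    out-neighbour s(v) of each v gives an injective, hence bijective, map
--    on the finite vertex set, and s(v) is the unique out-neighbour of v.
--    So walks follow s, every vertex lies on the s-orbit of u, and an
--    orbit covering a set of N elements under an injective map is a cycle
--    of length exactly N: listing it gives a hamiltonian cycle.

open import Defs
open import Data.Nat using (ℕ; _≤_; _+_; _*_)
open import Data.Product using (∃-syntax)
open import Relation.Nullary using (¬_)

open import Data.Nat using (zero; suc; _<_; z≤n; s≤s; NonZero)
open import Data.Nat.Properties
  using (m≤n⇒m≤1+n; ≤-reflexive; ≤-trans; ≤-antisym; ≤-<-trans; <⇒≱; <-cmp; 1+n≰n; n<1+n; m≤n+m;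
         +-cancelˡ-≤; +-mono-≤; +-monoˡ-≤; +-assoc; +-suc; m≤n⇒∃[o]m+o≡n; module ≤-Reasoning)
open import Data.Nat.DivMod using (_%_; _/_; m≡m%n+[m/n]*n; m%n<n)
open import Data.Nat.GeneralisedArithmetic using (fold; fold-+; iterate; iterate-is-fold)
open import Data.Nat.Solver using (module +-*-Solver)
open import Data.Bool using (Bool; true; false; T)
open import Data.Fin as F using (Fin; toℕ; fromℕ<; punchOut)
import Data.Fin.Properties as FP
open import Data.Sum using (inj₁; inj₂)
open import Data.Sum.Properties using (≡-dec; inj₁-injective; inj₂-injective)
open import Data.Product using (_×_; _,_; proj₁; proj₂; ∃)
open import Data.Unit using (tt)
open import Relation.Nullary using (Dec; yes; no; contradiction)
open import Relation.Nullary.Decidable using (T?; _×-dec_)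
open import Relation.Binary.PropositionalEquality
open import Relation.Binary.Definitions using (tri<; tri≈; tri>)
open import Relation.Binary.Construct.Closure.ReflexiveTransitive using (Star; ε; _◅_)
open import Function.Base using (_∘_)
open import Function.Bundles using (_↔_; Inverse)
open import Function.Definitions using (Injective; Surjective)

count-≤ : ∀ {n} (p : Fin n → Bool) → count p ≤ n
count-≤ {zero}  p = z≤n
count-≤ {suc n} p with p F.zero
... | true  = s≤s (count-≤ (p ∘ F.suc))
... | false = m≤n⇒m≤1+n (count-≤ (p ∘ F.suc))

count-none : ∀ {n} (p : Fin n → Bool) → (∀ i → ¬ T (p i)) → count p ≡ 0
count-none {zero}  p none = refl
count-none {suc n} p none with p F.zero in p0
... | true  = contradiction (subst T (sym p0) tt) (none F.zero)
... | false = count-none (p ∘ F.suc) (none ∘ F.suc)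

count-≤1 : ∀ {n} (p : Fin n → Bool) → (∀ i j → T (p i) → T (p j) → i ≡ j) → count p ≤ 1
count-≤1 {zero}  p unique = z≤n
count-≤1 {suc n} p unique with p F.zero in p0
... | true  = ≤-reflexive (cong suc (count-none (p ∘ F.suc) zero-only))
  where
  zero-only : ∀ i → ¬ T (p (F.suc i))
  zero-only i pi with unique F.zero (F.suc i) (subst T (sym p0) tt) pi
  ... | ()
... | false = count-≤1 (p ∘ F.suc) (λ i j pi pj → FP.suc-injective (unique _ _ pi pj))

count-full : ∀ {n} (p : Fin n → Bool) → n ≤ count p → ∀ i → T (p i)
count-full {suc n} p full i with p F.zero in p0
count-full {suc n} p full       F.zero    | true  = subst T (sym p0) tt
count-full {suc n} p (s≤s full) (F.suc i) | true  = count-full (p ∘ F.suc) full i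
count-full {suc n} p full       i         | false = contradiction (≤-trans full (count-≤ _)) 1+n≰n

forced-in-degree : ∀ {a o₁ i₁ o₂ i₂} → 3 * a + 1 ≤ (o₁ + i₁) + (o₂ + i₂) →
                   o₁ ≤ a → i₁ ≤ 1 → o₂ ≤ a → a ≤ i₂
forced-in-degree {a} {o₁} {i₁} {o₂} {i₂} bound o₁≤a i₁≤1 o₂≤a =
  +-cancelˡ-≤ (a + 1 + a) a i₂ (begin
    a + 1 + a + a          ≡⟨ regroup ⟩
    3 * a + 1              ≤⟨ bound ⟩
    (o₁ + i₁) + (o₂ + i₂)  ≤⟨ +-mono-≤ (+-mono-≤ o₁≤a i₁≤1) (+-monoˡ-≤ i₂ o₂≤a) ⟩
    (a + 1) + (a + i₂)     ≡⟨ sym (+-assoc (a + 1) a i₂) ⟩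
    a + 1 + a + i₂         ∎)
  where
  open ≤-Reasoning
  open +-*-Solver
  regroup : a + 1 + a + a ≡ 3 * a + 1
  regroup = solve 1 (λ a → a :+ con 1 :+ a :+ a := con 3 :* a :+ con 1) refl a

in-saturated : ∀ {a} (P Q : Fin a → Fin a → Bool) (s s' : Fin a) →
  3 * a + 1 ≤ (count (P s) + count (λ t → Q t s)) + (count (P s') + count (λ t → Q t s')) →
  count (λ t → Q t s) ≤ 1 → ∀ t → T (Q t s')
in-saturated P Q s s' bound one =
  count-full (λ t → Q t s') (forced-in-degree bound (count-≤ (P s)) one (count-≤ (P s')))

-- An injective endomap of Fin n is surjective: a missed value would let
-- punchOut squeeze Fin n injectively into Fin (n - 1).
fin-injective⇒surjective : ∀ {n} (f : Fin n → Fin n) → Injective _≡_ _≡_ f →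
                           ∀ y → ∃ λ x → f x ≡ y
fin-injective⇒surjective {suc m} f f-inj y with FP.any? (λ x → f x FP.≟ y)
... | yes hit = hit
... | no miss = contradiction (FP.injective⇒≤ squeeze-injective) 1+n≰n
  where
  missed : ∀ x → y ≢ f x
  missed x e = miss (x , sym e)
  squeeze : Fin (suc m) → Fin m
  squeeze x = punchOut (missed x)
  squeeze-injective : Injective _≡_ _≡_ squeeze
  squeeze-injective {x} {x'} = f-inj ∘ FP.punchOut-injective (missed x) (missed x')

difference : ∀ {i j} → i < j → ∃ λ d → j ≡ i + suc d
difference {i} i<j with d , i+1+d≡j ← m≤n⇒∃[o]m+o≡n i<j = d , trans (sym i+1+d≡j) (sym (+-suc i d))

module FiniteType {A : Set} {N : ℕ} (enum : Fin N ↔ A) where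
  open Inverse enum using (to; from; strictlyInverseˡ; strictlyInverseʳ)

  to-injective : Injective _≡_ _≡_ to
  to-injective {i} {j} e = trans (sym (strictlyInverseʳ i)) (trans (cong from e) (strictlyInverseʳ j))

  from-injective : Injective _≡_ _≡_ from
  from-injective {x} {y} e = trans (sym (strictlyInverseˡ x)) (trans (cong to e) (strictlyInverseˡ y))

  exists? : ∀ {P : A → Set} → (∀ x → Dec (P x)) → Dec (∃ P)
  exists? {P} P? with FP.any? (P? ∘ to)
  ... | yes (i , p) = yes (to i , p)
  ... | no none     = no λ (x , p) → none (from x , subst P (sym (strictlyInverseˡ x)) p)

  injective⇒surjective : (f : A → A) → Injective _≡_ _≡_ f → ∀ y → ∃ λ x → f x ≡ y
  injective⇒surjective f f-inj y
    with i , e ← fin-injective⇒surjective (from ∘ f ∘ to)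
                   (to-injective ∘ f-inj ∘ from-injective) (from y)
    = to i , from-injective e

  module Orbit (s : A → A) (s-injective : Injective _≡_ _≡_ s) (u : A)
               (visits : ∀ w → ∃ λ k → fold u s k ≡ w) .{{_ : NonZero N}} where

    orbit : ℕ → A
    orbit k = fold u s k

    fold-injective : ∀ {x y} k → fold x s k ≡ fold y s k → x ≡ y
    fold-injective zero    e = e
    fold-injective (suc k) e = fold-injective k (s-injective e)

    returns : ∀ i d → orbit (i + d) ≡ orbit i → orbit d ≡ u
    returns i d e = fold-injective i (trans (sym (fold-+ u s i)) e)

    period-reduces : ∀ p .{{_ : NonZero p}} → orbit p ≡ u → ∀ k → orbit (k % p) ≡ orbit k
    period-reduces p back k = begin
      orbit (k % p)                        ≡⟨ cong (λ x → fold x s (k % p)) (sym (multiple (k / p))) ⟩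
      fold (orbit ((k / p) * p)) s (k % p) ≡⟨ sym (fold-+ u s (k % p)) ⟩
      orbit (k % p + (k / p) * p)          ≡⟨ cong orbit (sym (m≡m%n+[m/n]*n k p)) ⟩
      orbit k                              ∎
      where
      open ≡-Reasoning
      multiple : ∀ q → orbit (q * p) ≡ u
      multiple zero    = refl
      multiple (suc q) = trans (fold-+ u s p) (trans (cong (λ x → fold x s p) (multiple q)) back)

    -- A return time p lets every element be reached in fewer than p steps,
    -- so p ≥ N.
    period-≥ : ∀ p .{{_ : NonZero p}} → orbit p ≡ u → N ≤ p
    period-≥ p back = FP.injective⇒≤ {f = index ∘ to} (to-injective ∘ index-injective)
      where
      index : A → Fin p
      index w = fromℕ< (m%n<n (proj₁ (visits w)) p)
      index-correct : ∀ w → orbit (toℕ (index w)) ≡ w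
      index-correct w with k , reach ← visits w =
        trans (cong orbit (FP.toℕ-fromℕ< (m%n<n k p))) (trans (period-reduces p back k) reach)
      index-injective : Injective _≡_ _≡_ index
      index-injective {w} {w'} e =
        trans (sym (index-correct w)) (trans (cong (orbit ∘ toℕ) e) (index-correct w'))

    -- Pigeonhole on orbit 0 … orbit N gives a return within N steps.
    period-≤ : ∃ λ d → orbit (suc d) ≡ u × suc d ≤ N
    period-≤ with FP.pigeonhole (n<1+n N) (from ∘ orbit ∘ toℕ)
    ... | i , j , i<j , e with difference i<j
    ... | d , j≡i+1+d = d , returns (toℕ i) (suc d) (trans (cong orbit (sym j≡i+1+d)) (sym (from-injective e)))
          , ≤-trans (m≤n+m (suc d) (toℕ i)) (≤-trans (≤-reflexive (sym j≡i+1+d)) (FP.toℕ≤pred[n] j))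

    closes : orbit N ≡ u
    closes with d , back , d<N ← period-≤ =
      subst (λ k → orbit k ≡ u) (≤-antisym d<N (period-≥ (suc d) back)) back

    listing : Fin N → A
    listing i = orbit (toℕ i)

    no-early-return : ∀ {i j} → i < j → j < N → orbit i ≢ orbit j
    no-early-return {i} {j} i<j j<N e with d , j≡i+1+d ← difference i<j =
      <⇒≱ (≤-<-trans (m≤n+m (suc d) i) (subst (_< N) j≡i+1+d j<N))
          (period-≥ (suc d) (returns i (suc d) (trans (cong orbit (sym j≡i+1+d)) (sym e))))

    listing-injective : Injective _≡_ _≡_ listing
    listing-injective {i} {j} e with <-cmp (toℕ i) (toℕ j)
    ... | tri< i<j _ _ = contradiction e (no-early-return i<j (FP.toℕ<n j))
    ... | tri≈ _ i≡j _ = FP.toℕ-injective i≡j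
    ... | tri> _ _ j<i = contradiction (sym e) (no-early-return j<i (FP.toℕ<n i))

    listing-surjective : Surjective _≡_ _≡_ listing
    listing-surjective w with k , reach ← visits w =
      fromℕ< (m%n<n k N) , λ { refl →
        trans (cong orbit (FP.toℕ-fromℕ< (m%n<n k N))) (trans (period-reduces N closes k) reach) }

walk-follows : ∀ {A : Set} {R : A → A → Set} (s : A → A) →
               (∀ {v w} → R v w → w ≡ s v) →
               ∀ {x w} → Star R x w → ∃ λ k → iterate s x k ≡ w
walk-follows s follows ε = 0 , refl
walk-follows s follows (_◅_ {i = x} {j = y} x→y walk) with k , reach ← walk-follows s follows walk =
  suc k , subst (λ z → iterate s z k ≡ _) (follows {x} {y} x→y) reach

first-step : ∀ {A : Set} {R : A → A → Set} {x y} → Star R x y → x ≢ y → ∃ (R x)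
first-step ε                   x≢x = contradiction refl x≢x
first-step (_◅_ {j = z} x→z _) _   = z , x→z

module _ {a : ℕ} (D : BBDigraph a) where
  open BBDigraph D

  vertices : Fin (a + a) ↔ Vertex a
  vertices = FP.+↔⊎

  open FiniteType vertices using (exists?)

  Unpaired : Vertex a → Set
  Unpaired v = ¬ ∃ (DominatingPair D v)

  -- Equality of vertices, arcs and partners are decidable; the theorem
  -- must exhibit a partner, so it decides whether one exists.
  _≟_ : (v w : Vertex a) → Dec (v ≡ w)
  _≟_ = ≡-dec FP._≟_ FP._≟_

  arc? : ∀ v w → Dec (Arc D v w)
  arc? (inj₁ x) (inj₁ _) = no λ ()
  arc? (inj₁ x) (inj₂ y) = T? (XY x y)
  arc? (inj₂ y) (inj₁ x) = T? (YX y x)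
  arc? (inj₂ y) (inj₂ _) = no λ ()

  partner? : ∀ u → Dec (∃ (DominatingPair D u))
  partner? u = exists? dominating?
    where
    dominating? : ∀ v → Dec (DominatingPair D u v)
    dominating? v with u ≟ v | exists? (λ w → arc? u w ×-dec arc? v w)
    ... | yes u≡v | _          = no λ (u≢v , _) → u≢v u≡v
    ... | no u≢v  | yes common = yes (u≢v , common)
    ... | no _    | no none    = no λ (_ , common) → none common

  sole-in-neighbour : ∀ {v v' w} → Unpaired v → Arc D v w → Arc D v' w → v' ≡ v
  sole-in-neighbour {v} {v'} {w} lone v→w v'→w with v' ≟ v
  ... | yes v'≡v = v'≡v
  ... | no v'≢v  = contradiction (v' , (λ e → v'≢v (sym e)) , w , v→w , v'→w) lone

  unpaired-in-degree : ∀ {v w} → Unpaired v → Arc D v w → indeg D w ≤ 1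
  unpaired-in-degree {w = inj₁ x} lone v→w =
    count-≤1 (λ y → YX y x) (λ y y' y→x y'→x →
      inj₂-injective (trans (sole-in-neighbour {v' = inj₂ y} lone v→w y→x)
                            (sym (sole-in-neighbour {v' = inj₂ y'} lone v→w y'→x))))
  unpaired-in-degree {w = inj₂ y} lone v→w =
    count-≤1 (λ x → XY x y) (λ x x' x→y x'→y →
      inj₁-injective (trans (sole-in-neighbour {v' = inj₁ x} lone v→w x→y)
                            (sym (sole-in-neighbour {v' = inj₁ x'} lone v→w x'→y))))

  -- In a strongly connected bipartite digraph every vertex has an
  -- out-neighbour: the walk to a vertex of the other side starts with one.
  out-neighbour : StronglyConnected D → ∀ v → ∃ (Arc D v)
  out-neighbour strong (inj₁ x) = first-step (strong (inj₁ x) (inj₂ x)) λ ()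
  out-neighbour strong (inj₂ y) = first-step (strong (inj₂ y) (inj₁ y)) λ ()

-- A second element of Fin (2 + b), distinct from the given one; this is
-- where a ≥ 2 is used.
other : ∀ {b} → Fin (suc (suc b)) → Fin (suc (suc b))
other F.zero    = F.suc F.zero
other (F.suc _) = F.zero

other-≢ : ∀ {b} (i : Fin (suc (suc b))) → other i ≢ i
other-≢ F.zero    ()
other-≢ (F.suc _) ()

module _ {b : ℕ} (D : BBDigraph (suc (suc b)))
         (degree-condition : (u v : Vertex (suc (suc b))) → DominatingPair D u v →
                             3 * suc (suc b) + 1 ≤ deg D u + deg D v) where
  open BBDigraph D

  sibling-pair : (side : Fin (suc (suc b)) → Vertex (suc (suc b))) → Injective _≡_ _≡_ side →
                 ∀ t {z} → (∀ t → Arc D (side t) z) → DominatingPair D (side t) (side (other t))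
  sibling-pair side side-injective t into =
    (λ e → other-≢ t (sym (side-injective e))) , _ , into t , into (other t)

  -- If v is unpaired, v → w and {w, w'} were dominating, then d⁻(w) ≤ 1
  -- and the degree condition saturates the in-neighbourhood of w'; so v
  -- and its sibling would both point to w', pairing v.
  unpaired-spreads : ∀ {v w} → Unpaired D v → Arc D v w → Unpaired D w
  unpaired-spreads {inj₂ y₀} {inj₁ x} lone y₀→x (inj₁ x' , x≢x' , inj₂ y , x→y , x'→y) =
    lone (_ , sibling-pair inj₂ inj₂-injective y₀ {inj₁ x'}
                (in-saturated XY YX x x' (degree-condition _ _ (x≢x' , inj₂ y , x→y , x'→y))
                              (unpaired-in-degree D {w = inj₁ x} lone y₀→x)))
  unpaired-spreads {inj₂ _} {inj₁ _} lone _ (_ , _ , inj₁ _ , () , _)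
  unpaired-spreads {inj₂ _} {inj₁ _} lone _ (inj₂ _ , _ , inj₂ _ , _ , ())
  unpaired-spreads {inj₁ x₀} {inj₂ y} lone x₀→y (inj₂ y' , y≢y' , inj₁ x , y→x , y'→x) =
    lone (_ , sibling-pair inj₁ inj₁-injective x₀ {inj₂ y'}
                (in-saturated YX XY y y' (degree-condition _ _ (y≢y' , inj₁ x , y→x , y'→x))
                              (unpaired-in-degree D {w = inj₂ y} lone x₀→y)))
  unpaired-spreads {inj₁ _} {inj₂ _} lone _ (_ , _ , inj₂ _ , () , _)
  unpaired-spreads {inj₁ _} {inj₂ _} lone _ (inj₁ _ , _ , inj₁ _ , _ , ())

  unpaired-along : ∀ {v w} → Unpaired D v → Star (Arc D) v w → Unpaired D w
  unpaired-along lone ε            = lone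
  unpaired-along lone (v→v' ◅ walk) = unpaired-along (unpaired-spreads lone v→v') walk

module _ {b : ℕ} (D : BBDigraph (suc b)) (strong : StronglyConnected D)
         (lonely : ∀ v → Unpaired D v) where
  open FiniteType (vertices D) using (injective⇒surjective; module Orbit)

  next : Vertex (suc b) → Vertex (suc b)
  next v = proj₁ (out-neighbour D strong v)

  next-arc : ∀ v → Arc D v (next v)
  next-arc v = proj₂ (out-neighbour D strong v)

  -- Two vertices with the same chosen out-neighbour would be paired.
  next-injective : Injective _≡_ _≡_ next
  next-injective {v} {v'} e =
    sole-in-neighbour D {v'} {v} (lonely v') (next-arc v') (subst (Arc D v) e (next-arc v))

  next-unique : ∀ {v w} → Arc D v w → w ≡ next v
  next-unique {v} {w} v→w with v' , e ← injective⇒surjective next next-injective w =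
    trans (sym e) (cong next (sole-in-neighbour D {v} {v'} (lonely v) v→w (subst (Arc D v') e (next-arc v'))))

  -- Every vertex lies on the orbit of a fixed start vertex, since walks
  -- from it follow next.
  start : Vertex (suc b)
  start = inj₁ F.zero

  visits : ∀ w → ∃ λ k → fold start next k ≡ w
  visits w with k , reach ← walk-follows next (λ {v} {w} → next-unique {v} {w}) (strong start w) =
    k , trans (iterate-is-fold start next k) reach

  open Orbit next next-injective start visits

  hamiltonian : Hamiltonian D
  hamiltonian = listing , (listing-injective , listing-surjective) , cycle-arcs
    where
    -- Consecutive positions are joined by next; the last position
    -- (N - 1 = b + suc b) returns to start because the orbit closes.
    cycle-arcs : (i j : Fin (suc b + suc b)) → CycNext D i j → Arc D (listing i) (listing j)
    cycle-arcs i j (inj₁ j≡1+i) =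
      subst (Arc D (listing i) ∘ orbit) (sym j≡1+i) (next-arc (listing i))
    cycle-arcs i j (inj₂ (i≡last , j≡0)) =
      subst₂ (λ k m → Arc D (orbit k) (orbit m)) (sym i≡last) (sym j≡0)
             (subst (Arc D (orbit (b + suc b))) closes (next-arc (orbit (b + suc b))))

lemma3p1 : (a : ℕ) → 2 ≤ a → (D : BBDigraph a) →
    StronglyConnected D →
    ((u v : Vertex a) → DominatingPair D u v → 3 * a + 1 ≤ deg D u + deg D v) →
    ¬ Hamiltonian D →
    (u : Vertex a) → ∃[ v ] DominatingPair D u v
lemma3p1 (suc (suc b)) (s≤s (s≤s _)) D strong degree-condition not-hamiltonian u
  with partner? D u
... | yes partner = partner
... | no lone     = contradiction (hamiltonian D strong lonely) not-hamiltonian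
  where
  lonely : ∀ w → Unpaired D w
  lonely w = unpaired-along D degree-condition lone (strong u w)
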